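{- For an integer $t\geq 1$, let $D^t=G(\mathbb{Z},\{1,2,\ldots,t\})$. Then, as $t\to\infty$, $\chi_{\rho}(D^t)\leq (1+o(1))3^t$ and $\chi_{\rho}(D^t)=\Omega(e^t)$.
   Context: For a graph $G$, a packing $k$-coloring is a map $f:V(G)\to\{1,\ldots,k\}$ such that any two distinct vertices $u,v$ with $f(u)=f(v)=i$ satisfy $d_G(u,v)\geq i+1$ ($d_G$ the graph distance). The packing chromatic number $\chi_{\rho}(G)$ is the least $k$ for which a packing $k$-coloring exists. For a set $D$ of positive integers, the distance graph $G(\mathbb{Z},D)$ has vertex set $\mathbb{Z}$, two distinct integers $i,j$ being adjacent iff $|i-j|\in D$. -}

module Defs where

open import Data.Nat as ℕ using (ℕ; zero; suc)
open import Data.Integer as ℤ using (ℤ; +_; ∣_∣)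
open import Data.Rational as ℚ using (ℚ; 0ℚ; 1ℚ)
open import Data.Product using (_×_)
open import Relation.Nullary using (¬_)
open import Relation.Binary.PropositionalEquality using (_≡_; _≢_)

-- Distance graph G(ℤ, D), D given as a predicate on ℕ (a set of positive integers):
-- distinct integers i, j adjacent iff |i - j| ∈ D.
Adj : (ℕ → Set) → ℤ → ℤ → Set
Adj D u v = u ≢ v × D ∣ u ℤ.- v ∣

data Walk (D : ℕ → Set) : ℕ → ℤ → ℤ → Set where
  nil  : ∀ {u} → Walk D zero u u
  step : ∀ {n u w v} → Adj D u w → Walk D n w v → Walk D (suc n) u v

DistGE : (ℕ → Set) → ℕ → ℤ → ℤ → Set
DistGE D m u v = ∀ n → n ℕ.< m → ¬ Walk D n u v

IsPackingColoring : (ℕ → Set) → ℕ → (ℤ → ℕ) → Set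
IsPackingColoring D k f =
  (∀ x → 1 ℕ.≤ f x × f x ℕ.≤ k) ×
  (∀ u v → u ≢ v → f u ≡ f v → DistGE D (suc (f u)) u v)

Dset : ℕ → ℕ → Set
Dset t n = 1 ℕ.≤ n × n ℕ.≤ t

_^ℚ_ : ℚ → ℕ → ℚ
q ^ℚ zero = 1ℚ
q ^ℚ suc n = q ℚ.* (q ^ℚ n)

expTerm : ℕ → ℕ → ℚ
expTerm t zero = 1ℚ
expTerm t (suc n) = expTerm t n ℚ.* ((+ t) ℚ./ suc n)

-- partial sum  Σ_{n=0}^{N} t^n / n!   (these increase to e^t)
expPartial : ℕ → ℕ → ℚ
expPartial t zero = 1ℚ
expPartial t (suc N) = expPartial t N ℚ.+ expTerm t (suc N)

module Submission where

open import Defs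
open import Data.Nat as ℕ using (ℕ)
open import Data.Integer using (ℤ; +_)
open import Data.Rational as ℚ using (ℚ; 0ℚ; 1ℚ; _/_)
open import Data.Product using (_×_; ∃-syntax)

open import Data.Nat using (zero; suc; z≤n; s≤s)
import Data.Nat.Properties as ℕP
import Data.Integer as ℤ
open import Data.Integer using (∣_∣)
import Data.Integer.Properties as ℤP
open import Data.Product using (_,_; proj₁; proj₂)
open import Data.Empty using (⊥-elim)
open import Relation.Binary.PropositionalEquality

-- Geometry: a walk of length n in D^t moves at most n·t, and naturals at
-- distance d ≤ n·t are joined by a walk of length at most n.  Hence f is a
-- packing colouring as soon as vertices of equal colour i are more than i·t
-- apart, and in every packing colouring they are.
--
-- UpperBound: with period 10t, a vertex x with residue r receives a colour
-- from a block of blockLength r colours reserved for r, chosen by its level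
-- ⌊x/10t⌋ modulo blockLength r.  Each block has about a ninth of the size of
-- all earlier blocks, which keeps equal colours far apart, and the number of
-- colours, about (10/9)^(10t), is at most 3^t for t ≥ 60.
--
-- Counting: colour i occupies at most one of any i·t + 1 consecutive
-- naturals; counting all colours on an interval of length t·K yields
-- t·K ≤ Σ_{i≤k} ⌊K/i⌋, hence t ≤ H_k, the k-th harmonic number.
--
-- ExponentialBound: the discrete mean value inequality
-- P_N(x + h) ≤ P_N(x) + h·P_N(x + h) gives P_N(H_k) ≤ 4k, and so
-- P_N(t) ≤ P_N(H_k) ≤ 4k.

module Geometry where
  open import Data.Nat using (_≤_; _<_; _+_; _*_; _∸_)
  open import Data.Integer.Tactic.RingSolver using (solve-∀)
  open import Relation.Nullary using (yes; no)

  distance-triangle : ∀ u w v → ∣ u ℤ.- v ∣ ≤ ∣ u ℤ.- w ∣ + ∣ w ℤ.- v ∣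
  distance-triangle u w v =
    subst (λ z → ∣ z ∣ ≤ ∣ u ℤ.- w ∣ + ∣ w ℤ.- v ∣) (telescope u w v)
          (ℤP.∣i+j∣≤∣i∣+∣j∣ (u ℤ.- w) (w ℤ.- v))
    where
    telescope : ∀ u w v → (u ℤ.- w) ℤ.+ (w ℤ.- v) ≡ u ℤ.- v
    telescope = solve-∀

  walk-displacement : ∀ {t n u v} → Walk (Dset t) n u v → ∣ u ℤ.- v ∣ ≤ n * t
  walk-displacement {u = u} nil = ℕP.≤-reflexive (cong ∣_∣ (ℤP.+-inverseʳ u))
  walk-displacement {u = u} {v = v} (step {w = w} (_ , _ , |u-w|≤t) walk) =
    ℕP.≤-trans (distance-triangle u w v) (ℕP.+-mono-≤ |u-w|≤t (walk-displacement walk))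

  distance-shift : ∀ x d → ∣ + x ℤ.- + (x + d) ∣ ≡ d
  distance-shift x d = begin
    ∣ + x ℤ.- + (x + d) ∣ ≡⟨ cong ∣_∣ (ℤP.[+m]-[+n]≡m⊖n x (x + d)) ⟩
    ∣ x ℤ.⊖ (x + d) ∣     ≡⟨ ℤP.∣⊖∣-≤ (ℕP.m≤m+n x d) ⟩
    (x + d) ∸ x           ≡⟨ ℕP.m+n∸m≡n x d ⟩
    d                     ∎
    where open ≡-Reasoning

  shift-≢ : ∀ x e → + x ≢ + (x + suc e)
  shift-≢ x e x≡x+1+e = ℕP.m≢1+m+n x (trans (cong ∣_∣ x≡x+1+e) (ℕP.+-suc x e))

  edge : ∀ {t} x e → suc e ≤ t → Adj (Dset t) (+ x) (+ (x + suc e))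
  edge x e 1+e≤t = shift-≢ x e ,
    subst (λ d → 1 ≤ d × d ≤ _) (sym (distance-shift x (suc e))) (s≤s z≤n , 1+e≤t)

  -- Conversely (t ≥ 1), x and x + d with 1 ≤ d ≤ n·t are joined by a walk of
  -- length at most n: take steps of length t until at most t remains.
  short-walk : ∀ t' n x e → suc e ≤ n * suc t' →
               ∃[ m ] (m ≤ n × Walk (Dset (suc t')) m (+ x) (+ (x + suc e)))
  short-walk t' (suc n) x e 1+e≤[1+n]t with suc e ℕ.≤? suc t'
  ... | yes 1+e≤t = 1 , s≤s z≤n , step (edge x e 1+e≤t) nil
  ... | no  1+e≰t = extend (short-walk t' n (x + t) (e ∸ t) rest≤nt)
    where
    t = suc t'
    t≤e : t ≤ e
    t≤e = ℕP.≤-pred (ℕP.≰⇒> 1+e≰t)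

    rest≤nt : suc (e ∸ t) ≤ n * t
    rest≤nt = begin
      suc (e ∸ t)      ≡⟨ ℕP.+-∸-assoc 1 t≤e ⟨
      suc e ∸ t        ≤⟨ ℕP.∸-monoˡ-≤ t 1+e≤[1+n]t ⟩
      (t + n * t) ∸ t  ≡⟨ ℕP.m+n∸m≡n t (n * t) ⟩
      n * t            ∎
      where open ℕP.≤-Reasoning

    endpoint : x + t + suc (e ∸ t) ≡ x + suc e
    endpoint = begin
      x + t + suc (e ∸ t)   ≡⟨ ℕP.+-assoc x t _ ⟩
      x + (t + suc (e ∸ t)) ≡⟨ cong (λ y → x + y) (ℕP.+-suc t _) ⟩
      x + suc (t + (e ∸ t)) ≡⟨ cong (λ y → x + suc y) (ℕP.m+[n∸m]≡n t≤e) ⟩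
      x + suc e             ∎
      where open ≡-Reasoning

    extend : ∃[ m ] (m ≤ n × Walk (Dset t) m (+ (x + t)) (+ (x + t + suc (e ∸ t)))) →
             ∃[ m ] (m ≤ suc n × Walk (Dset t) m (+ x) (+ (x + suc e)))
    extend (m , m≤n , walk) = suc m , s≤s m≤n ,
      step (edge x t' ℕP.≤-refl) (subst (λ y → Walk (Dset t) m (+ (x + t)) (+ y)) endpoint walk)

  -- Vertices of equal colour i that are more than i·t apart never violate the
  -- packing condition: a walk of length at most i covers distance at most i·t.
  packing-from-gaps : ∀ {t k} (f : ℤ → ℕ) → (∀ x → 1 ≤ f x × f x ≤ k) →
                      (∀ u v → u ≢ v → f u ≡ f v → f u * t < ∣ u ℤ.- v ∣) →
                      IsPackingColoring (Dset t) k f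
  packing-from-gaps {t} f range gap = range , λ u v u≢v same n n<1+fu walk →
    ℕP.<⇒≱ (gap u v u≢v same)
      (ℕP.≤-trans (walk-displacement walk) (ℕP.*-monoˡ-≤ t (ℕP.≤-pred n<1+fu)))

  -- Conversely, in a packing colouring of D^t (t ≥ 1), two naturals of equal
  -- colour i are more than i·t apart, since otherwise a short walk joins them.
  packing-gap : ∀ {t' k} {f : ℤ → ℕ} → IsPackingColoring (Dset (suc t')) k f →
                ∀ x e → f (+ x) ≡ f (+ (x + suc e)) → f (+ x) * suc t' < suc e
  packing-gap {t'} {f = f} (_ , packing) x e same with f (+ x) * suc t' ℕ.<? suc e
  ... | yes far  = far
  ... | no  near =
    let (m , m≤fx , walk) = short-walk t' (f (+ x)) x e (ℕP.≮⇒≥ near)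
    in  ⊥-elim (packing (+ x) (+ (x + suc e)) (shift-≢ x e) same m (s≤s m≤fx) walk)

module UpperBound where
  open Geometry
  open import Data.Nat using (_≤_; _<_; _+_; _*_; _^_; _∸_; _≤′_; ≤′-refl; ≤′-step)
  open import Data.Nat.DivMod using (_%_; m≡m%n+[m/n]*n; m%n<n; m/n*n≤m)
  open import Data.Nat.Tactic.RingSolver using (solve-∀)
  open import Algebra.Properties.CommutativeSemigroup ℕP.*-commutativeSemigroup
    using (x∙yz≈y∙xz; xy∙z≈y∙xz)
  open import Data.Integer.DivMod using (_/ℕ_; _%ℕ_; a≡a%ℕn+[a/ℕn]*n; n%ℕd<d)
  open import Data.Integer.Tactic.RingSolver renaming (solve-∀ to solve-∀ℤ)
  open import Relation.Binary.Definitions using (tri<; tri≈; tri>)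
  open import Function using (_∘_)

  residue-difference : ∀ a b m .{{_ : ℕ.NonZero m}} → a %ℕ m ≡ b %ℕ m →
                       ∣ a ℤ.- b ∣ ≡ ∣ a /ℕ m ℤ.- b /ℕ m ∣ * m
  residue-difference a b m same = begin
    ∣ a ℤ.- b ∣                              ≡⟨ cong₂ (λ x y → ∣ x ℤ.- y ∣) (a≡a%ℕn+[a/ℕn]*n a m) b≡ ⟩
    ∣ (r ℤ.+ qa ℤ.* + m) ℤ.- (r ℤ.+ qb ℤ.* + m) ∣ ≡⟨ cong ∣_∣ (cancel r qa qb (+ m)) ⟩
    ∣ (qa ℤ.- qb) ℤ.* + m ∣                   ≡⟨ ℤP.∣i*j∣≡∣i∣*∣j∣ (qa ℤ.- qb) (+ m) ⟩
    ∣ qa ℤ.- qb ∣ * m                         ∎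
    where
    open ≡-Reasoning
    r  = + (a %ℕ m)
    qa = a /ℕ m
    qb = b /ℕ m
    b≡ : b ≡ r ℤ.+ qb ℤ.* + m
    b≡ = trans (a≡a%ℕn+[a/ℕn]*n b m) (cong (λ s → + s ℤ.+ qb ℤ.* + m) (sym same))
    cancel : ∀ r x y z → (r ℤ.+ x ℤ.* z) ℤ.- (r ℤ.+ y ℤ.* z) ≡ (x ℤ.- y) ℤ.* z
    cancel = solve-∀ℤ

  residue-quotient-injective : ∀ a b m .{{_ : ℕ.NonZero m}} →
                               a %ℕ m ≡ b %ℕ m → a /ℕ m ≡ b /ℕ m → a ≡ b
  residue-quotient-injective a b m same-residue same-quotient = begin
    a                                 ≡⟨ a≡a%ℕn+[a/ℕn]*n a m ⟩
    + (a %ℕ m) ℤ.+ a /ℕ m ℤ.* + m     ≡⟨ cong₂ (λ r q → + r ℤ.+ q ℤ.* + m) same-residue same-quotient ⟩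
    + (b %ℕ m) ℤ.+ b /ℕ m ℤ.* + m     ≡⟨ a≡a%ℕn+[a/ℕn]*n b m ⟨
    b                                 ∎
    where open ≡-Reasoning

  residue-separation : ∀ a b m .{{_ : ℕ.NonZero m}} → a %ℕ m ≡ b %ℕ m → a ≢ b →
                       m ≤ ∣ a ℤ.- b ∣
  residue-separation a b m same a≢b =
    subst (m ≤_) (sym (residue-difference a b m same))
          (ℕP.m≤n*m m _ {{ℕ.≢-nonZero quotients-differ}})
    where
    quotients-differ : ∣ a /ℕ m ℤ.- b /ℕ m ∣ ≢ 0
    quotients-differ ≡0 = a≢b (residue-quotient-injective a b m same
      (ℤP.i-j≡0⇒i≡j _ _ (ℤP.∣i∣≡0⇒i≡0 ≡0)))

  -- Residue r will own the colours offset r + 1, …,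
  -- offset r + blockLength r; each block is about a ninth of all colours
  -- used before it, so offsets grow by a factor of about 10/9.
  offset : ℕ → ℕ
  offset zero    = 0
  offset (suc r) = offset r + suc (offset r ℕ./ 9)

  blockLength : ℕ → ℕ
  blockLength r = suc (offset r ℕ./ 9)

  offset-mono : ∀ {r s} → r ≤ s → offset r ≤ offset s
  offset-mono r≤s = mono (ℕP.≤⇒≤′ r≤s)
    where
    mono : ∀ {r s} → r ≤′ s → offset r ≤ offset s
    mono ≤′-refl        = ℕP.≤-refl
    mono (≤′-step r≤′s) = ℕP.≤-trans (mono r≤′s) (ℕP.m≤m+n _ _)

  block-below : ∀ {r s a b} → a < blockLength r → r < s → offset r + a < offset s + b
  block-below {r} {s} {a} {b} a<len r<s = ℕP.<-≤-trans
    (ℕP.+-monoʳ-< (offset r) a<len)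
    (ℕP.≤-trans (offset-mono r<s) (ℕP.m≤m+n (offset s) b))

  block-unique : ∀ {r s a b} → a < blockLength r → b < blockLength s →
                 offset r + a ≡ offset s + b → r ≡ s
  block-unique {r} {s} {a} {b} a<len b<len same with ℕP.<-cmp r s
  ... | tri≈ _ r≡s _ = r≡s
  ... | tri< r<s _ _ = ⊥-elim (ℕP.<-irrefl same (block-below {b = b} a<len r<s))
  ... | tri> _ _ s<r = ⊥-elim (ℕP.<-irrefl (sym same) (block-below {b = a} b<len s<r))

  offset<9·blockLength : ∀ r → offset r < 9 * blockLength r
  offset<9·blockLength r = begin-strict
    offset r                            ≡⟨ m≡m%n+[m/n]*n (offset r) 9 ⟩
    offset r % 9 + offset r ℕ./ 9 * 9   <⟨ ℕP.+-monoˡ-< (offset r ℕ./ 9 * 9) (m%n<n (offset r) 9) ⟩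
    9 + offset r ℕ./ 9 * 9              ≡⟨ ℕP.*-comm 9 (blockLength r) ⟨
    9 * blockLength r                   ∎
    where open ℕP.≤-Reasoning

  offset-growth : ∀ n → 9 * (offset (suc n) + 9) ≤ 10 * (offset n + 9)
  offset-growth n = begin
    9 * (A + suc q + 9)   ≡⟨ expand A q ⟩
    9 * A + q * 9 + 90    ≤⟨ ℕP.+-monoˡ-≤ 90 (ℕP.+-monoʳ-≤ (9 * A) (m/n*n≤m A 9)) ⟩
    9 * A + A + 90        ≡⟨ collect A ⟩
    10 * (A + 9)          ∎
    where
    open ℕP.≤-Reasoning
    A = offset n
    q = A ℕ./ 9
    expand : ∀ A q → 9 * (A + suc q + 9) ≡ 9 * A + q * 9 + 90
    expand = solve-∀
    collect : ∀ A → 9 * A + A + 90 ≡ 10 * (A + 9)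
    collect = solve-∀

  offset-exponential : ∀ n → 9 ^ n * (offset n + 9) ≤ 9 * 10 ^ n
  offset-exponential zero    = ℕP.≤-refl
  offset-exponential (suc n) = begin
    9 * 9 ^ n * (offset (suc n) + 9)    ≡⟨ xy∙z≈y∙xz 9 (9 ^ n) _ ⟩
    9 ^ n * (9 * (offset (suc n) + 9))  ≤⟨ ℕP.*-monoʳ-≤ (9 ^ n) (offset-growth n) ⟩
    9 ^ n * (10 * (offset n + 9))       ≡⟨ x∙yz≈y∙xz (9 ^ n) 10 _ ⟩
    10 * (9 ^ n * (offset n + 9))       ≤⟨ ℕP.*-monoʳ-≤ 10 (offset-exponential n) ⟩
    10 * (9 * 10 ^ n)                   ≡⟨ x∙yz≈y∙xz 10 9 (10 ^ n) ⟩
    9 * (10 * 10 ^ n)                   ∎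
    where open ℕP.≤-Reasoning

  -- (10/9)^10 < 3, so 9·(10/9)^(10m) ≤ 3^m once m ≥ 60.
  tenth-powers : ∀ m → 60 ≤ m → 9 * 10 ^ (10 * m) ≤ 3 ^ m * 9 ^ (10 * m)
  tenth-powers m 60≤m = subst Bound (ℕP.m∸n+n≡m 60≤m) (from60 (m ∸ 60))
    where
    Bound : ℕ → Set
    Bound m = 9 * 10 ^ (10 * m) ≤ 3 ^ m * 9 ^ (10 * m)

    abstract
      base : Bound 60
      base = ℕP.≤ᵇ⇒≤ _ _ _

      ratio : 10 ^ 10 ≤ 3 * 9 ^ 10
      ratio = ℕP.≤ᵇ⇒≤ _ _ _

    power-step : ∀ b m → b ^ (10 * suc m) ≡ b ^ 10 * b ^ (10 * m)
    power-step b m = trans (cong (b ^_) (ℕP.*-suc 10 m)) (ℕP.^-distribˡ-+-* b 10 (10 * m))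

    next : ∀ m → Bound m → Bound (suc m)
    next m bound = begin
      9 * 10 ^ (10 * suc m)                  ≡⟨ cong (9 *_) (power-step 10 m) ⟩
      9 * (10 ^ 10 * 10 ^ (10 * m))          ≡⟨ x∙yz≈y∙xz 9 (10 ^ 10) (10 ^ (10 * m)) ⟩
      10 ^ 10 * (9 * 10 ^ (10 * m))          ≤⟨ ℕP.*-mono-≤ ratio bound ⟩
      3 * 9 ^ 10 * (3 ^ m * 9 ^ (10 * m))    ≡⟨ ℕP.[m*n]*[o*p]≡[m*o]*[n*p] 3 (9 ^ 10) (3 ^ m) _ ⟩
      3 * 3 ^ m * (9 ^ 10 * 9 ^ (10 * m))    ≡⟨ cong (3 ^ suc m *_) (power-step 9 m) ⟨
      3 ^ suc m * 9 ^ (10 * suc m)           ∎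
      where open ℕP.≤-Reasoning

    from60 : ∀ d → Bound (d + 60)
    from60 zero    = base
    from60 (suc d) = next (d + 60) (from60 d)

  -- The colouring below uses offset (10·t) colours, at most 3^t when t ≥ 60.
  palette-bound : ∀ t → 60 ≤ t → offset (10 * t) ≤ 3 ^ t
  palette-bound t 60≤t = ℕP.*-cancelˡ-≤ (9 ^ (10 * t)) {{ℕP.m^n≢0 9 (10 * t)}} (begin
    9 ^ (10 * t) * offset (10 * t)         ≤⟨ ℕP.*-monoʳ-≤ (9 ^ (10 * t)) (ℕP.m≤m+n _ 9) ⟩
    9 ^ (10 * t) * (offset (10 * t) + 9)   ≤⟨ offset-exponential (10 * t) ⟩
    9 * 10 ^ (10 * t)                      ≤⟨ tenth-powers t 60≤t ⟩
    3 ^ t * 9 ^ (10 * t)                   ≡⟨ ℕP.*-comm (3 ^ t) _ ⟩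
    9 ^ (10 * t) * 3 ^ t                   ∎)
    where open ℕP.≤-Reasoning

  module PeriodicColouring (t' : ℕ) where
    t : ℕ
    t = suc t'

    period : ℕ
    period = 10 * t

    residue : ℤ → ℕ
    residue x = x %ℕ period

    level : ℤ → ℤ
    level x = x /ℕ period

    slot : ℤ → ℕ
    slot x = level x %ℕ blockLength (residue x)

    colour : ℤ → ℕ
    colour x = suc (offset (residue x) + slot x)

    colour-in-block : ∀ x → colour x ≤ offset (residue x) + blockLength (residue x)
    colour-in-block x = subst (_≤ offset (residue x) + blockLength (residue x))
      (ℕP.+-suc (offset (residue x)) (slot x))
      (ℕP.+-monoʳ-≤ (offset (residue x)) (n%ℕd<d (level x) (blockLength (residue x))))

    colour-range : ∀ x → 1 ≤ colour x × colour x ≤ offset period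
    colour-range x = s≤s z≤n ,
      ℕP.≤-trans (colour-in-block x) (offset-mono (n%ℕd<d x period))

    colour-short : ∀ x → colour x * t < blockLength (residue x) * period
    colour-short x = begin-strict
      colour x * t                  ≤⟨ ℕP.*-monoˡ-≤ t (colour-in-block x) ⟩
      (offset r + len) * t          <⟨ ℕP.*-monoˡ-< t (ℕP.+-monoˡ-< len (offset<9·blockLength r)) ⟩
      (9 * len + len) * t           ≡⟨ rearrange len t ⟩
      len * period                  ∎
      where
      open ℕP.≤-Reasoning
      r   = residue x
      len = blockLength r
      rearrange : ∀ m t → (9 * m + m) * t ≡ m * (10 * t)
      rearrange = solve-∀

    -- Vertices of equal colour have the same residue and levels congruent
    -- modulo the block length, hence lie blockLength · period apart.
    same-colour-far : ∀ u v → u ≢ v → colour u ≡ colour v →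
                      blockLength (residue u) * period ≤ ∣ u ℤ.- v ∣
    same-colour-far u v u≢v same = subst (blockLength (residue u) * period ≤_)
      (sym (residue-difference u v period residues-equal))
      (ℕP.*-monoˡ-≤ period (residue-separation (level u) (level v) _ slots-equal levels-differ))
      where
      residues-equal : residue u ≡ residue v
      residues-equal = block-unique (n%ℕd<d (level u) _) (n%ℕd<d (level v) _) (ℕP.suc-injective same)
      slots-equal : slot u ≡ level v %ℕ blockLength (residue u)
      slots-equal = ℕP.+-cancelˡ-≡ (offset (residue u)) _ _ (trans (ℕP.suc-injective same)
        (cong (λ r → offset r + level v %ℕ blockLength r) (sym residues-equal)))
      levels-differ : level u ≢ level v
      levels-differ = u≢v ∘ residue-quotient-injective u v period residues-equal

    packing : IsPackingColoring (Dset t) (offset period) colour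
    packing = packing-from-gaps colour colour-range λ u v u≢v same →
      ℕP.<-≤-trans (colour-short u) (same-colour-far u v u≢v same)

  few-colours : ∀ t → 60 ≤ t → ∃[ k ] ∃[ f ] (IsPackingColoring (Dset t) k f × k ≤ 3 ^ t)
  few-colours (suc t') 60≤t = offset period , colour , packing , palette-bound (suc t') 60≤t
    where open PeriodicColouring t'

module Counting where
  open Geometry
  open import Data.Nat using (_≤_; _<_; _+_; _*_; _∸_)
  open import Data.Nat.DivMod using (m/n*n≡m; /-monoʳ-≤; /-congʳ; m*n/m*o≡n/o)
  open import Data.Nat.Divisibility using (_∣_)
  open import Algebra.Properties.CommutativeSemigroup ℕP.+-commutativeSemigroup
    using (interchange)
  open import Relation.Nullary using (yes; no)
  open import Data.Sum using (inj₁; inj₂)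
  open import Function using (case_of_)

  sumBelow : ℕ → (ℕ → ℕ) → ℕ
  sumBelow zero    F = 0
  sumBelow (suc n) F = sumBelow n F + F n

  sumBelow-cong : ∀ n {F G : ℕ → ℕ} → (∀ j → j < n → F j ≡ G j) → sumBelow n F ≡ sumBelow n G
  sumBelow-cong zero    F≡G = refl
  sumBelow-cong (suc n) F≡G =
    cong₂ _+_ (sumBelow-cong n (λ j j<n → F≡G j (ℕP.m<n⇒m<1+n j<n))) (F≡G n ℕP.≤-refl)

  sumBelow-zero : ∀ n {F : ℕ → ℕ} → (∀ j → j < n → F j ≡ 0) → sumBelow n F ≡ 0
  sumBelow-zero zero    F≡0 = refl
  sumBelow-zero (suc n) F≡0 =
    cong₂ _+_ (sumBelow-zero n (λ j j<n → F≡0 j (ℕP.m<n⇒m<1+n j<n))) (F≡0 n ℕP.≤-refl)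

  sumBelow-one : ∀ n → sumBelow n (λ _ → 1) ≡ n
  sumBelow-one zero    = refl
  sumBelow-one (suc n) = trans (cong (_+ 1) (sumBelow-one n)) (ℕP.+-comm n 1)

  sumBelow-mono : ∀ n {F G : ℕ → ℕ} → (∀ j → j < n → F j ≤ G j) → sumBelow n F ≤ sumBelow n G
  sumBelow-mono zero    F≤G = z≤n
  sumBelow-mono (suc n) F≤G =
    ℕP.+-mono-≤ (sumBelow-mono n (λ j j<n → F≤G j (ℕP.m<n⇒m<1+n j<n))) (F≤G n ℕP.≤-refl)

  sumBelow-+ : ∀ n (F G : ℕ → ℕ) → sumBelow n (λ j → F j + G j) ≡ sumBelow n F + sumBelow n G
  sumBelow-+ zero    F G = refl
  sumBelow-+ (suc n) F G =
    trans (cong (_+ (F n + G n)) (sumBelow-+ n F G)) (interchange (sumBelow n F) (sumBelow n G) (F n) (G n))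

  sumBelow-swap : ∀ m n (F : ℕ → ℕ → ℕ) →
                  sumBelow m (λ i → sumBelow n (F i)) ≡ sumBelow n (λ j → sumBelow m (λ i → F i j))
  sumBelow-swap m zero    F = sumBelow-zero m (λ _ _ → refl)
  sumBelow-swap m (suc n) F =
    trans (sumBelow-+ m (λ i → sumBelow n (F i)) (λ i → F i n))
          (cong (_+ sumBelow m (λ i → F i n)) (sumBelow-swap m n F))

  sumBelow-split : ∀ m n (F : ℕ → ℕ) → sumBelow (m + n) F ≡ sumBelow m F + sumBelow n (λ j → F (m + j))
  sumBelow-split m zero    F = trans (cong (λ z → sumBelow z F) (ℕP.+-identityʳ m)) (sym (ℕP.+-identityʳ _))
  sumBelow-split m (suc n) F = begin
    sumBelow (m + suc n) F                                      ≡⟨ cong (λ z → sumBelow z F) (ℕP.+-suc m n) ⟩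
    sumBelow (m + n) F + F (m + n)                              ≡⟨ cong (_+ F (m + n)) (sumBelow-split m n F) ⟩
    sumBelow m F + sumBelow n (λ j → F (m + j)) + F (m + n)     ≡⟨ ℕP.+-assoc (sumBelow m F) _ _ ⟩
    sumBelow m F + (sumBelow n (λ j → F (m + j)) + F (m + n))   ∎
    where open ≡-Reasoning

  indicator : ℕ → ℕ → ℕ
  indicator a b with a ℕ.≟ b
  ... | yes _ = 1
  ... | no  _ = 0

  indicator-≡ : ∀ {a b} → a ≡ b → indicator a b ≡ 1
  indicator-≡ {a} {b} a≡b with a ℕ.≟ b
  ... | yes _   = refl
  ... | no  a≢b = ⊥-elim (a≢b a≡b)

  indicator-≢ : ∀ {a b} → a ≢ b → indicator a b ≡ 0
  indicator-≢ {a} {b} a≢b with a ℕ.≟ b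
  ... | yes a≡b = ⊥-elim (a≢b a≡b)
  ... | no  _   = refl

  exactly-one : ∀ {v} k → 1 ≤ v → v ≤ k → sumBelow k (λ j → indicator v (suc j)) ≡ 1
  exactly-one zero    1≤v v≤0 = ⊥-elim (ℕP.<⇒≱ 1≤v v≤0)
  exactly-one {v} (suc k) 1≤v v≤1+k with ℕP.m≤n⇒m<n∨m≡n v≤1+k
  ... | inj₂ v≡1+k = cong₂ _+_
          (sumBelow-zero k (λ j j<k → indicator-≢ λ v≡1+j → ℕP.<-irrefl (trans (sym v≡1+j) v≡1+k) (s≤s j<k)))
          (indicator-≡ v≡1+k)
  ... | inj₁ v<1+k = trans
          (cong₂ _+_ (exactly-one k 1≤v (ℕP.≤-pred v<1+k)) (indicator-≢ (ℕP.<⇒≢ v<1+k)))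
          (ℕP.+-identityʳ 1)

  module ColourDensity {t' k} {f : ℤ → ℕ} (packing : IsPackingColoring (Dset (suc t')) k f) where
    t : ℕ
    t = suc t'

    occurrences : ℕ → ℕ → ℕ → ℕ
    occurrences i a n = sumBelow n (λ y → indicator (f (+ (a + y))) i)

    occurrences-split : ∀ i a m n → occurrences i a (m + n) ≡ occurrences i a m + occurrences i (a + m) n
    occurrences-split i a m n = trans (sumBelow-split m n _)
      (cong (λ z → occurrences i a m + z) (sumBelow-cong n λ y _ →
        cong (λ x → indicator (f (+ x)) i) (sym (ℕP.+-assoc a m y))))

    -- Colour i occurs at most once among i·t + 1 consecutive naturals: if the
    -- last of them has colour i, every earlier one is within distance i·t.
    window : ∀ i a n → n ≤ suc (i * t) → occurrences i a n ≤ 1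
    window i a zero    _          = z≤n
    window i a (suc n) n+1≤1+it = case f (+ (a + n)) ℕ.≟ i of λ where
        (no last≢i) → begin
          occurrences i a n + indicator (f (+ (a + n))) i ≡⟨ cong (λ z → occurrences i a n + z) (indicator-≢ last≢i) ⟩
          occurrences i a n + 0                           ≡⟨ ℕP.+-identityʳ _ ⟩
          occurrences i a n                               ≤⟨ window i a n (ℕP.≤-trans (ℕP.n≤1+n n) n+1≤1+it) ⟩
          1                                               ∎
        (yes last≡i) → ℕP.≤-reflexive (cong₂ _+_
          (sumBelow-zero n (λ y y<n → indicator-≢ λ earlier≡i →
            ℕP.<⇒≱ (gap y y<n earlier≡i last≡i) (distance y y<n)))
          (indicator-≡ last≡i))
      where
      open ℕP.≤-Reasoning
      path : ∀ y → y < n → a + y + suc (n ∸ suc y) ≡ a + n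
      path y y<n = trans (ℕP.+-assoc a y _) (cong (λ z → a + z) (trans (ℕP.+-suc y _) (ℕP.m+[n∸m]≡n y<n)))
      distance : ∀ y → y < n → suc (n ∸ suc y) ≤ i * t
      distance y y<n = begin
        suc (n ∸ suc y) ≡⟨ ℕP.+-∸-assoc 1 y<n ⟨
        n ∸ y           ≤⟨ ℕP.m∸n≤m n y ⟩
        n               ≤⟨ ℕP.≤-pred n+1≤1+it ⟩
        i * t           ∎
      gap : ∀ y → y < n → f (+ (a + y)) ≡ i → f (+ (a + n)) ≡ i → i * t < suc (n ∸ suc y)
      gap y y<n earlier≡i last≡i = subst (λ c → c * t < _) earlier≡i
        (packing-gap packing (a + y) (n ∸ suc y)
          (trans earlier≡i (sym (trans (cong (λ x → f (+ x)) (path y y<n)) last≡i))))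

    blocks : ∀ i a j → occurrences i a (j * suc (i * t)) ≤ j
    blocks i a zero    = z≤n
    blocks i a (suc j) = begin
      occurrences i a (w + j * w)                        ≡⟨ occurrences-split i a w (j * w) ⟩
      occurrences i a w + occurrences i (a + w) (j * w)  ≤⟨ ℕP.+-mono-≤ (window i a w ℕP.≤-refl) (blocks i (a + w) j) ⟩
      suc j                                              ∎
      where
      open ℕP.≤-Reasoning
      w = suc (i * t)

    frequency : ∀ i L → suc (i * t) ∣ L → occurrences i 0 L ≤ L ℕ./ suc (i * t)
    frequency i L w∣L = subst (λ n → occurrences i 0 n ≤ L ℕ./ suc (i * t)) (m/n*n≡m w∣L)
                              (blocks i 0 (L ℕ./ suc (i * t)))

    partition : ∀ L → sumBelow k (λ j → occurrences (suc j) 0 L) ≡ L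
    partition L = begin
      sumBelow k (λ j → occurrences (suc j) 0 L)                         ≡⟨ sumBelow-swap k L _ ⟩
      sumBelow L (λ y → sumBelow k (λ j → indicator (f (+ y)) (suc j)))  ≡⟨ sumBelow-cong L one-colour ⟩
      sumBelow L (λ _ → 1)                                               ≡⟨ sumBelow-one L ⟩
      L                                                                  ∎
      where
      open ≡-Reasoning
      one-colour : ∀ y → y < L → sumBelow k (λ j → indicator (f (+ y)) (suc j)) ≡ 1
      one-colour y _ = exactly-one k (proj₁ (proj₁ packing (+ y))) (proj₂ (proj₁ packing (+ y)))

    -- Comparing the sizes of the colour classes with the length t·K of an
    -- interval gives t ≤ Σ_{i≤k} 1/i, in the form t·K ≤ Σ_{i≤k} ⌊K/i⌋.
    harmonic-count : ∀ K → (∀ j → j < k → suc (suc j * t) ∣ t * K) →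
                     t * K ≤ sumBelow k (λ j → K ℕ./ suc j)
    harmonic-count K divides = begin
      t * K                                               ≡⟨ partition (t * K) ⟨
      sumBelow k (λ j → occurrences (suc j) 0 (t * K))    ≤⟨ sumBelow-mono k (λ j j<k → frequency (suc j) (t * K) (divides j j<k)) ⟩
      sumBelow k (λ j → t * K ℕ./ suc (suc j * t))        ≤⟨ sumBelow-mono k (λ j _ → spacing j) ⟩
      sumBelow k (λ j → K ℕ./ suc j)                      ∎
      where
      open ℕP.≤-Reasoning
      spacing : ∀ j → t * K ℕ./ suc (suc j * t) ≤ K ℕ./ suc j
      spacing j = begin
        t * K ℕ./ suc (suc j * t)   ≤⟨ /-monoʳ-≤ (t * K) (ℕP.n≤1+n (suc j * t)) ⟩
        t * K ℕ./ (suc j * t)       ≡⟨ /-congʳ {m = t * K} (ℕP.*-comm (suc j) t) ⟩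
        t * K ℕ./ (t * suc j)       ≡⟨ m*n/m*o≡n/o t K (suc j) ⟩
        K ℕ./ suc j                 ∎

module ExponentialBound where
  open Counting using (sumBelow)
  open import Data.Nat.DivMod using (m/n*n≤m)
  open import Data.Rational using (mkℚ; _+_; _*_; _≤_; _<_; -_)
  import Data.Rational.Properties as ℚP
  open import Data.Rational.Solver using (module +-*-Solver)
  open import Data.Nat.Coprimality using (1-coprimeTo) renaming (sym to coprime-sym)
  open import Algebra.Properties.CommutativeSemigroup ℕP.*-commutativeSemigroup
    using (x∙yz≈z∙yx)

  ι : ℕ → ℚ
  ι n = mkℚ (+ n) 0 (coprime-sym (1-coprimeTo n))

  ι-≡ : ∀ n → + n / 1 ≡ ι n
  ι-≡ n = ℚP.↥p/↧p≡p (ι n)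

  ι-+ : ∀ a b → ι (a ℕ.+ b) ≡ ι a + ι b
  ι-+ a b = trans (sym (ι-≡ (a ℕ.+ b)))
    (cong₂ (λ x y → (x ℤ.+ y) / 1) (sym (ℤP.*-identityʳ (+ a))) (sym (ℤP.*-identityʳ (+ b))))

  ι-* : ∀ a b → ι (a ℕ.* b) ≡ ι a * ι b
  ι-* a b = sym (trans (cong (_/ 1) (ℤP.+◃n≡+n (a ℕ.* b))) (ι-≡ (a ℕ.* b)))

  ι-mono : ∀ {a b} → a ℕ.≤ b → ι a ≤ ι b
  ι-mono {a} {b} a≤b = ℚ.*≤* (subst₂ ℤ._≤_ (sym (ℤP.*-identityʳ (+ a))) (sym (ℤP.*-identityʳ (+ b))) (ℤ.+≤+ a≤b))

  ι-nonneg : ∀ n → 0ℚ ≤ ι n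
  ι-nonneg n = ι-mono z≤n

  inv : ℕ → ℚ
  inv n = ℚ.1/ ι (suc n)

  inv-nonneg : ∀ n → 0ℚ ≤ inv n
  inv-nonneg n = ℚ.*≤* (ℤ.+≤+ z≤n)

  inv-positive : ∀ n → 0ℚ < inv n
  inv-positive n = ℚ.*<* (ℤ.+<+ (s≤s z≤n))

  ι-inv : ∀ n → ι (suc n) * inv n ≡ 1ℚ
  ι-inv n = ℚP.*-inverseʳ (ι (suc n))

  *-monoʳ-nonneg : ∀ {p q} r → 0ℚ ≤ r → p ≤ q → p * r ≤ q * r
  *-monoʳ-nonneg r 0≤r = ℚP.*-monoʳ-≤-nonNeg r {{ℚ.nonNegative 0≤r}}

  *-monoˡ-nonneg : ∀ {p q} r → 0ℚ ≤ r → p ≤ q → r * p ≤ r * q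
  *-monoˡ-nonneg r 0≤r = ℚP.*-monoˡ-≤-nonNeg r {{ℚ.nonNegative 0≤r}}

  *-nonneg : ∀ {a b} → 0ℚ ≤ a → 0ℚ ≤ b → 0ℚ ≤ a * b
  *-nonneg {a} {b} 0≤a 0≤b = subst (_≤ a * b) (ℚP.*-zeroˡ b) (*-monoʳ-nonneg b 0≤b 0≤a)

  +-nonneg : ∀ {a b} → 0ℚ ≤ a → 0ℚ ≤ b → 0ℚ ≤ a + b
  +-nonneg = ℚP.+-mono-≤

  ≤-+-nonneg : ∀ a {b} → 0ℚ ≤ b → a ≤ a + b
  ≤-+-nonneg a {b} 0≤b = subst (_≤ a + b) (ℚP.+-identityʳ a) (ℚP.+-monoʳ-≤ a 0≤b)

  *-mono-nonneg : ∀ {a b c d} → 0ℚ ≤ a → 0ℚ ≤ c → a ≤ b → c ≤ d → a * c ≤ b * d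
  *-mono-nonneg {b = b} {c} 0≤a 0≤c a≤b c≤d =
    ℚP.≤-trans (*-monoʳ-nonneg c 0≤c a≤b) (*-monoˡ-nonneg b (ℚP.≤-trans 0≤a a≤b) c≤d)

  harmonic : ℕ → ℚ
  harmonic zero    = 0ℚ
  harmonic (suc k) = harmonic k + inv k

  harmonic-nonneg : ∀ k → 0ℚ ≤ harmonic k
  harmonic-nonneg zero    = ℚP.≤-refl
  harmonic-nonneg (suc k) = +-nonneg (harmonic-nonneg k) (inv-nonneg k)

  floor-quotient : ∀ K j → ι (K ℕ./ suc j) ≤ ι K * inv j
  floor-quotient K j = begin
    ι q                           ≡⟨ ℚP.*-identityʳ (ι q) ⟨
    ι q * 1ℚ                      ≡⟨ cong (ι q *_) (ι-inv j) ⟨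
    ι q * (ι (suc j) * inv j)     ≡⟨ ℚP.*-assoc (ι q) (ι (suc j)) (inv j) ⟨
    ι q * ι (suc j) * inv j       ≡⟨ cong (_* inv j) (ι-* q (suc j)) ⟨
    ι (q ℕ.* suc j) * inv j       ≤⟨ *-monoʳ-nonneg (inv j) (inv-nonneg j) (ι-mono (m/n*n≤m K (suc j))) ⟩
    ι K * inv j                   ∎
    where
    open ℚP.≤-Reasoning
    q = K ℕ./ suc j

  floor-harmonic : ∀ K k → ι (sumBelow k (λ j → K ℕ./ suc j)) ≤ ι K * harmonic k
  floor-harmonic K zero    = ℚP.≤-reflexive (sym (ℚP.*-zeroʳ (ι K)))
  floor-harmonic K (suc k) = begin
    ι (sumBelow k (λ j → K ℕ./ suc j) ℕ.+ K ℕ./ suc k)      ≡⟨ ι-+ (sumBelow k (λ j → K ℕ./ suc j)) (K ℕ./ suc k) ⟩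
    ι (sumBelow k (λ j → K ℕ./ suc j)) + ι (K ℕ./ suc k)  ≤⟨ ℚP.+-mono-≤ (floor-harmonic K k) (floor-quotient K k) ⟩
    ι K * harmonic k + ι K * inv k                          ≡⟨ ℚP.*-distribˡ-+ (ι K) (harmonic k) (inv k) ⟨
    ι K * harmonic (suc k)                                  ∎
    where open ℚP.≤-Reasoning

  harmonic-lower-bound : ∀ t K k → 1 ℕ.≤ K → t ℕ.* K ℕ.≤ sumBelow k (λ j → K ℕ./ suc j) →
                         ι t ≤ harmonic k
  harmonic-lower-bound t (suc K) k _ count = ℚP.*-cancelˡ-≤-pos (ι (suc K)) (begin
    ι (suc K) * ι t                                  ≡⟨ ι-* (suc K) t ⟨
    ι (suc K ℕ.* t)                                  ≡⟨ cong ι (ℕP.*-comm (suc K) t) ⟩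
    ι (t ℕ.* suc K)                                  ≤⟨ ι-mono count ⟩
    ι (sumBelow k (λ j → suc K ℕ./ suc j))          ≤⟨ floor-harmonic (suc K) k ⟩
    ι (suc K) * harmonic k                           ∎)
    where open ℚP.≤-Reasoning

  expTermℚ : ℚ → ℕ → ℚ
  expTermℚ x zero    = 1ℚ
  expTermℚ x (suc n) = expTermℚ x n * (x * inv n)

  expPartialℚ : ℚ → ℕ → ℚ
  expPartialℚ x zero    = 1ℚ
  expPartialℚ x (suc N) = expPartialℚ x N + expTermℚ x (suc N)

  expPartial-ℚ : ∀ t N → expPartial t N ≡ expPartialℚ (ι t) N
  expPartial-ℚ t zero    = refl
  expPartial-ℚ t (suc N) = cong₂ _+_ (expPartial-ℚ t N) (expTerm-ℚ (suc N))
    where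
    ratio : ∀ n → + t / suc n ≡ ι t * inv n
    ratio n = sym (ℚP./-cong (ℤP.*-identityʳ (+ t)) (ℕP.*-identityˡ (suc n)))
    expTerm-ℚ : ∀ n → expTerm t n ≡ expTermℚ (ι t) n
    expTerm-ℚ zero    = refl
    expTerm-ℚ (suc n) = cong₂ _*_ (expTerm-ℚ n) (ratio n)

  expTermℚ-nonneg : ∀ {x} → 0ℚ ≤ x → ∀ n → 0ℚ ≤ expTermℚ x n
  expTermℚ-nonneg 0≤x zero    = ι-nonneg 1
  expTermℚ-nonneg 0≤x (suc n) = *-nonneg (expTermℚ-nonneg 0≤x n) (*-nonneg 0≤x (inv-nonneg n))

  expTermℚ-mono : ∀ {x y} → 0ℚ ≤ x → x ≤ y → ∀ n → expTermℚ x n ≤ expTermℚ y n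
  expTermℚ-mono _   _   zero    = ℚP.≤-refl
  expTermℚ-mono 0≤x x≤y (suc n) = *-mono-nonneg (expTermℚ-nonneg 0≤x n) (*-nonneg 0≤x (inv-nonneg n))
    (expTermℚ-mono 0≤x x≤y n) (*-monoʳ-nonneg (inv n) (inv-nonneg n) x≤y)

  expPartialℚ-mono : ∀ {x y} → 0ℚ ≤ x → x ≤ y → ∀ N → expPartialℚ x N ≤ expPartialℚ y N
  expPartialℚ-mono _   _   zero    = ℚP.≤-refl
  expPartialℚ-mono 0≤x x≤y (suc N) = ℚP.+-mono-≤ (expPartialℚ-mono 0≤x x≤y N) (expTermℚ-mono 0≤x x≤y (suc N))

  expPartialℚ-zero : ∀ N → expPartialℚ 0ℚ N ≡ 1ℚ
  expPartialℚ-zero zero    = refl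
  expPartialℚ-zero (suc N) = trans (cong₂ _+_ (expPartialℚ-zero N) vanishing) (ℚP.+-identityʳ 1ℚ)
    where
    vanishing : expTermℚ 0ℚ (suc N) ≡ 0ℚ
    vanishing = trans (cong (expTermℚ 0ℚ N *_) (ℚP.*-zeroˡ (inv N))) (ℚP.*-zeroʳ (expTermℚ 0ℚ N))

  -- The derivative of x^(n+1)/(n+1)! is x^n/n!, in the form x·T_n(x) = (n+1)·T_{n+1}(x).
  expTermℚ-derivative : ∀ x n → x * expTermℚ x n ≡ ι (suc n) * expTermℚ x (suc n)
  expTermℚ-derivative x n = sym (begin
    ι (suc n) * (expTermℚ x n * (x * inv n))  ≡⟨ rearrange (ι (suc n)) (expTermℚ x n) x (inv n) ⟩
    x * expTermℚ x n * (ι (suc n) * inv n)    ≡⟨ cong (x * expTermℚ x n *_) (ι-inv n) ⟩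
    x * expTermℚ x n * 1ℚ                     ≡⟨ ℚP.*-identityʳ _ ⟩
    x * expTermℚ x n                          ∎)
    where
    open ≡-Reasoning
    open +-*-Solver
    rearrange : ∀ a b c d → a * (b * (c * d)) ≡ c * b * (a * d)
    rearrange = solve 4 (λ a b c d → a :* (b :* (c :* d)) := (c :* b) :* (a :* d)) refl

  -- Mean value inequality for a single term (x, h ≥ 0):
  --   T_{n+1}(x + h) ≤ T_{n+1}(x) + h·T_n(x + h),
  -- since T_{n+1}' = T_n is increasing.
  expTermℚ-mean-value : ∀ {x h} → 0ℚ ≤ x → 0ℚ ≤ h → ∀ n →
    expTermℚ (x + h) (suc n) ≤ expTermℚ x (suc n) + h * expTermℚ (x + h) n
  expTermℚ-mean-value {x} {h} _ _ zero = ℚP.≤-reflexive (base x h)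
    where
    open +-*-Solver
    base : ∀ x h → 1ℚ * ((x + h) * inv 0) ≡ 1ℚ * (x * inv 0) + h * 1ℚ
    base = solve 2 (λ x h → con 1ℚ :* ((x :+ h) :* con 1ℚ) := con 1ℚ :* (x :* con 1ℚ) :+ h :* con 1ℚ) refl
  expTermℚ-mean-value {x} {h} 0≤x 0≤h (suc n) = begin
    Ty₁ * (y * a)
      ≤⟨ *-monoʳ-nonneg (y * a) (*-nonneg 0≤y (inv-nonneg (suc n))) (expTermℚ-mean-value 0≤x 0≤h n) ⟩
    (Tx₁ + h * Ty₀) * (y * a)
      ≡⟨ expand x h Tx₁ Ty₀ a ⟩
    (x * Tx₁ + h * Tx₁ + h * (y * Ty₀)) * a
      ≤⟨ *-monoʳ-nonneg a (inv-nonneg (suc n)) (ℚP.+-mono-≤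
           (ℚP.+-monoʳ-≤ (x * Tx₁) (*-monoˡ-nonneg h 0≤h (expTermℚ-mono 0≤x x≤y (suc n))))
           (ℚP.≤-reflexive (cong (h *_) (expTermℚ-derivative y n)))) ⟩
    (x * Tx₁ + h * Ty₁ + h * (ι (suc n) * Ty₁)) * a
      ≡⟨ collect x h Tx₁ Ty₁ (ι (suc n)) a ⟩
    x * Tx₁ * a + h * Ty₁ * ((1ℚ + ι (suc n)) * a)
      ≡⟨ cong (λ z → x * Tx₁ * a + h * Ty₁ * z) (trans (cong (_* a) (sym (ι-+ 1 (suc n)))) (ι-inv (suc n))) ⟩
    x * Tx₁ * a + h * Ty₁ * 1ℚ
      ≡⟨ finish x h Tx₁ Ty₁ a ⟩
    expTermℚ x (suc (suc n)) + h * Ty₁ ∎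
    where
    open ℚP.≤-Reasoning
    open +-*-Solver
    y   = x + h
    a   = inv (suc n)
    Tx₁ = expTermℚ x (suc n)
    Ty₀ = expTermℚ y n
    Ty₁ = expTermℚ y (suc n)
    0≤y : 0ℚ ≤ y
    0≤y = +-nonneg 0≤x 0≤h
    x≤y : x ≤ y
    x≤y = ≤-+-nonneg x 0≤h
    expand : ∀ x h p q a → (p + h * q) * ((x + h) * a) ≡ (x * p + h * p + h * ((x + h) * q)) * a
    expand = solve 5 (λ x h p q a → (p :+ h :* q) :* ((x :+ h) :* a) := (x :* p :+ h :* p :+ h :* ((x :+ h) :* q)) :* a) refl
    collect : ∀ x h p q c a → (x * p + h * q + h * (c * q)) * a ≡ x * p * a + h * q * ((1ℚ + c) * a)
    collect = solve 6 (λ x h p q c a → (x :* p :+ h :* q :+ h :* (c :* q)) :* a := x :* p :* a :+ h :* q :* ((con 1ℚ :+ c) :* a)) refl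
    finish : ∀ x h p q a → x * p * a + h * q * 1ℚ ≡ p * (x * a) + h * q
    finish = solve 5 (λ x h p q a → x :* p :* a :+ h :* q :* con 1ℚ := p :* (x :* a) :+ h :* q) refl

  expPartialℚ-mean-value : ∀ {x h} → 0ℚ ≤ x → 0ℚ ≤ h → ∀ N →
    expPartialℚ (x + h) N + h * expTermℚ (x + h) N ≤ expPartialℚ x N + h * expPartialℚ (x + h) N
  expPartialℚ-mean-value _ _ zero = ℚP.≤-refl
  expPartialℚ-mean-value {x} {h} 0≤x 0≤h (suc N) = begin
    (Py + Ty₁) + h * Ty₁
      ≤⟨ ℚP.+-monoˡ-≤ (h * Ty₁) (ℚP.+-monoʳ-≤ Py (expTermℚ-mean-value 0≤x 0≤h N)) ⟩
    (Py + (Tx₁ + h * Ty₀)) + h * Ty₁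
      ≡⟨ regroup Py Tx₁ Ty₀ h Ty₁ ⟩
    (Py + h * Ty₀) + (Tx₁ + h * Ty₁)
      ≤⟨ ℚP.+-monoˡ-≤ (Tx₁ + h * Ty₁) (expPartialℚ-mean-value 0≤x 0≤h N) ⟩
    (Px + h * Py) + (Tx₁ + h * Ty₁)
      ≡⟨ factor Px Py Tx₁ h Ty₁ ⟩
    (Px + Tx₁) + h * (Py + Ty₁) ∎
    where
    open ℚP.≤-Reasoning
    open +-*-Solver
    y   = x + h
    Px  = expPartialℚ x N
    Py  = expPartialℚ y N
    Tx₁ = expTermℚ x (suc N)
    Ty₀ = expTermℚ y N
    Ty₁ = expTermℚ y (suc N)
    regroup : ∀ p u v h w → (p + (u + h * v)) + h * w ≡ (p + h * v) + (u + h * w)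
    regroup = solve 5 (λ p u v h w → (p :+ (u :+ h :* v)) :+ h :* w := (p :+ h :* v) :+ (u :+ h :* w)) refl
    factor : ∀ p q u h w → (p + h * q) + (u + h * w) ≡ (p + u) + h * (q + w)
    factor = solve 5 (λ p q u h w → (p :+ h :* q) :+ (u :+ h :* w) := (p :+ u) :+ h :* (q :+ w)) refl

  -- Discrete form of (e^(x+h) - e^x) ≤ h·e^(x+h):  P_N(x + h) ≤ P_N(x) + h·P_N(x + h).
  expPartialℚ-shift : ∀ {x h} → 0ℚ ≤ x → 0ℚ ≤ h → ∀ N →
                      expPartialℚ (x + h) N ≤ expPartialℚ x N + h * expPartialℚ (x + h) N
  expPartialℚ-shift {x} {h} 0≤x 0≤h N = ℚP.≤-trans
    (≤-+-nonneg (expPartialℚ (x + h) N) (*-nonneg 0≤h (expTermℚ-nonneg (+-nonneg 0≤x 0≤h) N)))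
    (expPartialℚ-mean-value 0≤x 0≤h N)

  expPartialℚ-reciprocal-shift : ∀ m {x} → 0ℚ ≤ x → ∀ N →
    ι m * expPartialℚ (x + inv m) N ≤ ι (suc m) * expPartialℚ x N
  expPartialℚ-reciprocal-shift m {x} 0≤x N = begin
    ι m * Q′                            ≡⟨ split (ι m) Q′ ⟩
    (1ℚ + ι m) * Q′ + - Q′              ≡⟨ cong (λ c → c * Q′ + - Q′) (ι-+ 1 m) ⟨
    ι (suc m) * Q′ + - Q′               ≤⟨ ℚP.+-monoˡ-≤ (- Q′) (*-monoˡ-nonneg (ι (suc m)) (ι-nonneg (suc m)) shift) ⟩
    ι (suc m) * (Q + inv m * Q′) + - Q′ ≡⟨ expand (ι (suc m)) Q (inv m) Q′ ⟩
    ι (suc m) * Q + (ι (suc m) * inv m) * Q′ + - Q′ ≡⟨ cong (λ z → ι (suc m) * Q + z * Q′ + - Q′) (ι-inv m) ⟩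
    ι (suc m) * Q + 1ℚ * Q′ + - Q′      ≡⟨ cancel (ι (suc m)) Q Q′ ⟩
    ι (suc m) * Q                       ∎
    where
    open ℚP.≤-Reasoning
    open +-*-Solver
    Q  = expPartialℚ x N
    Q′ = expPartialℚ (x + inv m) N
    shift : Q′ ≤ Q + inv m * Q′
    shift = expPartialℚ-shift 0≤x (inv-nonneg m) N
    split : ∀ c q → c * q ≡ (1ℚ + c) * q + - q
    split = solve 2 (λ c q → c :* q := (con 1ℚ :+ c) :* q :+ (:- q)) refl
    expand : ∀ c q i q′ → c * (q + i * q′) + - q′ ≡ c * q + (c * i) * q′ + - q′
    expand = solve 4 (λ c q i q′ → c :* (q :+ i :* q′) :+ (:- q′) := c :* q :+ (c :* i) :* q′ :+ (:- q′)) refl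
    cancel : ∀ c q q′ → c * q + 1ℚ * q′ + - q′ ≡ c * q
    cancel = solve 3 (λ c q q′ → c :* q :+ con 1ℚ :* q′ :+ (:- q′) := c :* q) refl

  -- Truncated exponentials of harmonic numbers: P_N(H_k) ≤ 4k for k ≥ 1.
  -- The base case uses H_1 = 1/2 + 1/2; each further step from H_m to
  -- H_{m+1} multiplies the bound by (m+1)/m.
  expPartialℚ-harmonic : ∀ k N → expPartialℚ (harmonic (suc k)) N ≤ ι (4 ℕ.* suc k)
  expPartialℚ-harmonic zero N = begin
    expPartialℚ ((0ℚ + half) + half) N        ≡⟨ ℚP.*-identityˡ (expPartialℚ ((0ℚ + half) + half) N) ⟨
    ι 1 * expPartialℚ ((0ℚ + half) + half) N  ≤⟨ expPartialℚ-reciprocal-shift 1 (+-nonneg ℚP.≤-refl (inv-nonneg 1)) N ⟩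
    ι 2 * expPartialℚ (0ℚ + half) N           ≡⟨ cong (ι 2 *_) (ℚP.*-identityˡ (expPartialℚ (0ℚ + half) N)) ⟨
    ι 2 * (ι 1 * expPartialℚ (0ℚ + half) N)   ≤⟨ *-monoˡ-nonneg (ι 2) (ι-nonneg 2) (expPartialℚ-reciprocal-shift 1 ℚP.≤-refl N) ⟩
    ι 2 * (ι 2 * expPartialℚ 0ℚ N)       ≡⟨ cong (λ z → ι 2 * (ι 2 * z)) (expPartialℚ-zero N) ⟩
    ι 4                                  ∎
    where
    open ℚP.≤-Reasoning
    half = inv 1
  expPartialℚ-harmonic (suc k) N = ℚP.*-cancelˡ-≤-pos (ι (suc k)) (begin
    ι (suc k) * expPartialℚ (harmonic (suc (suc k))) N
      ≤⟨ expPartialℚ-reciprocal-shift (suc k) (harmonic-nonneg (suc k)) N ⟩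
    ι (suc (suc k)) * expPartialℚ (harmonic (suc k)) N
      ≤⟨ *-monoˡ-nonneg (ι (suc (suc k))) (ι-nonneg _) (expPartialℚ-harmonic k N) ⟩
    ι (suc (suc k)) * ι (4 ℕ.* suc k)
      ≡⟨ ι-* (suc (suc k)) (4 ℕ.* suc k) ⟨
    ι (suc (suc k) ℕ.* (4 ℕ.* suc k))
      ≡⟨ cong ι (x∙yz≈z∙yx (suc (suc k)) 4 (suc k)) ⟩
    ι (suc k ℕ.* (4 ℕ.* suc (suc k)))
      ≡⟨ ι-* (suc k) (4 ℕ.* suc (suc k)) ⟩
    ι (suc k) * ι (4 ℕ.* suc (suc k)) ∎)
    where open ℚP.≤-Reasoning

  exp-below-colours : ∀ t k N → ι t ≤ harmonic (suc k) → inv 3 * expPartial t N ≤ + suc k / 1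
  exp-below-colours t k N t≤H = begin
    inv 3 * expPartial t N             ≡⟨ cong (inv 3 *_) (expPartial-ℚ t N) ⟩
    inv 3 * expPartialℚ (ι t) N        ≤⟨ *-monoˡ-nonneg (inv 3) (inv-nonneg 3)
                                            (ℚP.≤-trans (expPartialℚ-mono (ι-nonneg t) t≤H N) (expPartialℚ-harmonic k N)) ⟩
    inv 3 * ι (4 ℕ.* suc k)            ≡⟨ cong (inv 3 *_) (ι-* 4 (suc k)) ⟩
    inv 3 * (ι 4 * ι (suc k))          ≡⟨ ℚP.*-assoc (inv 3) (ι 4) (ι (suc k)) ⟨
    inv 3 * ι 4 * ι (suc k)            ≡⟨ cong (_* ι (suc k)) (trans (ℚP.*-comm (inv 3) (ι 4)) (ι-inv 3)) ⟩
    1ℚ * ι (suc k)                     ≡⟨ ℚP.*-identityˡ (ι (suc k)) ⟩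
    ι (suc k)                          ≡⟨ ι-≡ (suc k) ⟨
    + suc k / 1                        ∎
    where open ℚP.≤-Reasoning

  ι-power : ∀ m t → (+ m / 1) ^ℚ t ≡ ι (m ℕ.^ t)
  ι-power m zero    = refl
  ι-power m (suc t) = trans (cong₂ _*_ (ι-≡ m) (ι-power m t)) (sym (ι-* m (m ℕ.^ t)))

  below-power-of-three : ∀ k t ε → 0ℚ < ε → k ℕ.≤ 3 ℕ.^ t → + k / 1 ≤ (1ℚ + ε) * ((+ 3 / 1) ^ℚ t)
  below-power-of-three k t ε 0<ε k≤3^t = begin
    + k / 1                        ≡⟨ ι-≡ k ⟩
    ι k                            ≤⟨ ι-mono k≤3^t ⟩
    ι (3 ℕ.^ t)                    ≡⟨ ℚP.*-identityˡ (ι (3 ℕ.^ t)) ⟨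
    1ℚ * ι (3 ℕ.^ t)               ≤⟨ *-monoʳ-nonneg (ι (3 ℕ.^ t)) (ι-nonneg _) (≤-+-nonneg 1ℚ (ℚP.<⇒≤ 0<ε)) ⟩
    (1ℚ + ε) * ι (3 ℕ.^ t)         ≡⟨ cong ((1ℚ + ε) *_) (ι-power 3 t) ⟨
    (1ℚ + ε) * ((+ 3 / 1) ^ℚ t)    ∎
    where open ℚP.≤-Reasoning

module LowerBound where
  open Counting
  open ExponentialBound
  open import Data.Nat using (_≤_; _<_; _*_; _!)
  open import Data.Nat.Divisibility using (_∣_; ∣-trans; m∣m*n; n∣m*n; m≤n⇒m!∣n!)

  divides-factorial : ∀ {m n} → suc m ≤ n → suc m ∣ n !
  divides-factorial {m} m+1≤n = ∣-trans (m∣m*n (m !)) (m≤n⇒m!∣n! m+1≤n)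

  -- In a packing colouring of D^t with k colours, t ≤ H_k: apply the
  -- counting inequality with K = (k·t + 1)!, divisible by every i·t + 1, i ≤ k.
  colours-vs-harmonic : ∀ {t' k} {f : ℤ → ℕ} → IsPackingColoring (Dset (suc t')) k f →
                        ι (suc t') ℚ.≤ harmonic k
  colours-vs-harmonic {t'} {k} packing =
    harmonic-lower-bound t K k (ℕP.1≤n! (suc (k * t))) (harmonic-count K divisible)
    where
    open ColourDensity packing
    K = suc (k * t) !
    divisible : ∀ j → j < k → suc (suc j * t) ∣ t * K
    divisible j j<k = ∣-trans (divides-factorial (s≤s (ℕP.*-monoˡ-≤ t j<k))) (n∣m*n t)

  colours-exceed-exponential : ∀ {t' k} {f : ℤ → ℕ} → IsPackingColoring (Dset (suc t')) k f →
                               ∀ N → inv 3 ℚ.* expPartial (suc t') N ℚ.≤ (+ k / 1)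
  colours-exceed-exponential {k = zero} (range , _) N =
    ⊥-elim (ℕP.<⇒≱ (proj₁ (range (+ 0))) (proj₂ (range (+ 0))))
  colours-exceed-exponential {t'} {suc k} packing N =
    exp-below-colours (suc t') k N (colours-vs-harmonic packing)

open UpperBound using (few-colours)
open ExponentialBound using (inv; inv-positive; below-power-of-three)
open LowerBound using (colours-exceed-exponential)

proposition2 : (∀ (ε : ℚ) → 0ℚ ℚ.< ε → ∃[ T ] ∀ t → T ℕ.≤ t → 1 ℕ.≤ t →
    ∃[ k ] ∃[ f ] (IsPackingColoring (Dset t) k f
    × (+ k / 1) ℚ.≤ (1ℚ ℚ.+ ε) ℚ.* ((+ 3 / 1) ^ℚ t)))
    ×
    (∃[ c ] (0ℚ ℚ.< c × ∃[ T ] ∀ t → T ℕ.≤ t → 1 ℕ.≤ t →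
    ∀ (k : ℕ) (f : ℤ → ℕ) → IsPackingColoring (Dset t) k f →
    ∀ (N : ℕ) → c ℚ.* expPartial t N ℚ.≤ (+ k / 1)))
proposition2 =
  (λ ε 0<ε → 60 , λ t 60≤t _ →
     let (k , f , packing , k≤3^t) = few-colours t 60≤t
     in  k , f , packing , below-power-of-three k t ε 0<ε k≤3^t) ,
  (inv 3 , inv-positive 3 , 1 , λ where
     (suc t') _ _ k f packing → colours-exceed-exponential packing)
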